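{- Let $N$ be a neuron, $\mathit{inp}$ a list of input functions and $len\in\mathbb{N}$. If $N$ is initial and $w_N(id)\ge 0$ for every $id<len$, then $CurPot_N(\mathit{inp},len)\ge 0$.
   Context: Booleans are identified with $0$ (false) and $1$ (true). A neuron $N$ consists of an identifier $id_N\in\mathbb{N}$, a weight function $w_N:\mathbb{N}\to\mathbb{Q}$ with $-1\le w_N(x)\le 1$ for all $x$ and $w_N(id_N)=0$, a leak factor $lk_N\in\mathbb{Q}$ with $0\le lk_N\le 1$, a threshold $\tau_N\in\mathbb{Q}$ with $\tau_N>0$, an output list $Output(N)$ of booleans (most recent first) and a current potential $CurPot(N)\in\mathbb{Q}$, subject to: $(\tau_N\le CurPot(N))$ equals the head of $Output(N)$ (the head of an empty list being $0$). An input function is a map $i:\mathbb{N}\to\{0,1\}$; $potential(w,i,len)=\sum_{0\le k<len,\ i(k)=1} w(k)$. The one-step update of $N$ with input function $i$ in an environment of $len$ neurons keeps $id,w,lk,\tau$, sets the new potential $p=potential(w_N,i,len)$ if $\tau_N\le CurPot(N)$ and $p=potential(w_N,i,len)+lk_N\cdot CurPot(N)$ otherwise, and sets the new output list to $(\tau_N\le p)::Output(N)$. For a list of input functions (most recent first), $AfterNsteps(N,[\,],len)=N$ and $AfterNsteps(N,i::\mathit{inp},len)$ is the one-step update of $AfterNsteps(N,\mathit{inp},len)$ with $i$; $CurPot_N(\mathit{inp},len)$ denotes its current potential. $N$ is initial if $Output(N)=[0]$ and $CurPot(N)=0$. -}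

module Defs where

open import Data.Bool using (Bool; true; false; if_then_else_)
open import Data.Nat using (ℕ; zero; suc)
open import Data.List using (List; []; _∷_)
open import Data.Rational using (ℚ; 0ℚ; 1ℚ; _+_; _*_; _≤_; _<_; _≤ᵇ_; -_)
open import Data.Product using (_×_)
open import Relation.Binary.PropositionalEquality using (_≡_; refl)

headB : List Bool → Bool
headB []      = false
headB (b ∷ _) = b

record Neuron : Set where
  field
    id      : ℕ
    w       : ℕ → ℚ
    lk      : ℚ
    τ       : ℚ
    Output  : List Bool
    CurPot  : ℚ
    w-lo    : ∀ x → - 1ℚ ≤ w x
    w-hi    : ∀ x → w x ≤ 1ℚ
    w-self  : w id ≡ 0ℚ
    lk-lo   : 0ℚ ≤ lk
    lk-hi   : lk ≤ 1ℚ
    τ-pos   : 0ℚ < τ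
    inv     : (τ ≤ᵇ CurPot) ≡ headB Output

open Neuron public

Input : Set
Input = ℕ → Bool

potential : (ℕ → ℚ) → Input → ℕ → ℚ
potential w i zero    = 0ℚ
potential w i (suc k) = potential w i k + (if i k then w k else 0ℚ)

-- one-step update of N with input i in an environment of len neurons
NextNeuron : Neuron → Input → ℕ → Neuron
NextNeuron N i len = record
  { id = id N ; w = w N ; lk = lk N ; τ = τ N
  ; Output = (τ N ≤ᵇ p) ∷ Output N
  ; CurPot = p
  ; w-lo = w-lo N ; w-hi = w-hi N ; w-self = w-self N
  ; lk-lo = lk-lo N ; lk-hi = lk-hi N ; τ-pos = τ-pos N
  ; inv = refl }
  where
  p : ℚ
  p = if τ N ≤ᵇ CurPot N
        then potential (w N) i len
        else potential (w N) i len + lk N * CurPot N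

-- input list is most recent first
AfterNsteps : Neuron → List Input → ℕ → Neuron
AfterNsteps N []        len = N
AfterNsteps N (i ∷ inp) len = NextNeuron (AfterNsteps N inp len) i len

CurPotN : Neuron → List Input → ℕ → ℚ
CurPotN N inp len = CurPot (AfterNsteps N inp len)

IsInitial : Neuron → Set
IsInitial N = (Output N ≡ false ∷ []) × (CurPot N ≡ 0ℚ)

{-# OPTIONS --safe #-}
-- Each update sets the potential to a sum of weights of firing inputs, plus
-- lk · CurPot when the neuron did not fire; with nonnegative weights and
-- 0 ≤ lk, nonnegativity of the potential is preserved step by step.
module Submission where

open import Defs
open import Data.Nat using (ℕ; zero; suc)
open import Data.Nat as Nat using ()
open import Data.Nat.Properties using (m≤n⇒m≤1+n; ≤-refl)
open import Data.Bool using (true; false; if_then_else_)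
open import Data.List using (List; []; _∷_)
open import Data.Product using (_,_)
open import Data.Rational using (ℚ; 0ℚ; _≤_; _+_; _*_; _≤ᵇ_; nonNegative)
open import Data.Rational.Properties as ℚ
  using (nonNegative⁻¹; nonNeg+nonNeg⇒nonNeg; nonNeg*nonNeg⇒nonNeg)
open import Relation.Binary.PropositionalEquality using (_≡_; refl; sym; subst)

private variable p q : ℚ

0≤+ : 0ℚ ≤ p → 0ℚ ≤ q → 0ℚ ≤ p + q
0≤+ {p} {q} 0≤p 0≤q =
  nonNegative⁻¹ _ {{nonNeg+nonNeg⇒nonNeg p {{nonNegative 0≤p}} q {{nonNegative 0≤q}}}}

0≤* : 0ℚ ≤ p → 0ℚ ≤ q → 0ℚ ≤ p * q
0≤* {p} {q} 0≤p 0≤q =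
  nonNegative⁻¹ _ {{nonNeg*nonNeg⇒nonNeg p {{nonNegative 0≤p}} q {{nonNegative 0≤q}}}}

NonNegativeBelow : ℕ → (ℕ → ℚ) → Set
NonNegativeBelow len v = ∀ (k : ℕ) → k Nat.< len → 0ℚ ≤ v k

potential-nonNeg : ∀ {v} i len → NonNegativeBelow len v → 0ℚ ≤ potential v i len
potential-nonNeg         i zero      v≥0 = ℚ.≤-refl
potential-nonNeg {v = v} i (suc len) v≥0 =
  0≤+ (potential-nonNeg i len (λ k k<len → v≥0 k (m≤n⇒m≤1+n k<len))) input-term≥0
  where
  input-term≥0 : 0ℚ ≤ (if i len then v len else 0ℚ)
  input-term≥0 with i len
  ... | true  = v≥0 len ≤-refl
  ... | false = ℚ.≤-refl

w-AfterNsteps : ∀ N inp len → w (AfterNsteps N inp len) ≡ w N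
w-AfterNsteps N []        len = refl
w-AfterNsteps N (i ∷ inp) len = w-AfterNsteps N inp len

NextNeuron-CurPot-nonNeg : ∀ N i len → NonNegativeBelow len (w N) →
  0ℚ ≤ CurPot N → 0ℚ ≤ CurPot (NextNeuron N i len)
NextNeuron-CurPot-nonNeg N i len w≥0 pot≥0 with τ N ≤ᵇ CurPot N
... | true  = potential-nonNeg i len w≥0
... | false = 0≤+ (potential-nonNeg i len w≥0) (0≤* (lk-lo N) pot≥0)

CurPotN-nonNeg : ∀ N inp len → NonNegativeBelow len (w N) →
  0ℚ ≤ CurPot N → 0ℚ ≤ CurPotN N inp len
CurPotN-nonNeg N []        len w≥0 pot≥0 = pot≥0
CurPotN-nonNeg N (i ∷ inp) len w≥0 pot≥0 =
  NextNeuron-CurPot-nonNeg (AfterNsteps N inp len) i len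
    (subst (NonNegativeBelow len) (sym (w-AfterNsteps N inp len)) w≥0)
    (CurPotN-nonNeg N inp len w≥0 pot≥0)

lemma4p1 : (N : Neuron) (inp : List Input) (len : ℕ) →
    IsInitial N →
    (∀ (k : ℕ) → k Nat.< len → 0ℚ ≤ w N k) →
    0ℚ ≤ CurPotN N inp len
lemma4p1 N inp len (_ , CurPot≡0) w≥0 =
  CurPotN-nonNeg N inp len w≥0 (ℚ.≤-reflexive (sym CurPot≡0))
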